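{- Let $a=\sum_{n\in\mathbb{Z},\,n\equiv1\pmod 3}x^{n^2}\in\mathbb{Z}/2[[x]]$ and let $B(a)$ be the set of integers $n$ such that the coefficient of $x^n$ in the Laurent series $1/a$ is $1$. If $n\equiv 0\pmod 2$ and $n\in B(a)$, then $n/2$ is a perfect square.
   Context: $1/a$ is computed in the field of Laurent series over $\mathbb{Z}/2$. -}

module Defs where

open import Data.Bool using (Bool; true; false; _xor_; _∧_)
open import Data.Nat as ℕ using (ℕ; zero; suc; _∸_)
open import Data.Integer as ℤ using (ℤ; +_; -[1+_])
open import Data.Integer.DivMod using (_%_)
open import Data.List using (List; foldr; map; upTo; _++_)
open import Relation.Nullary.Decidable using (⌊_⌋)

-- The field Z/2 is modelled by Bool (xor = addition, ∧ = multiplication).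

sumF2 : List Bool → Bool
sumF2 = foldr _xor_ false

intRange : ℕ → List ℤ
intRange m = map +_ (upTo (suc m)) ++ map -[1+_] (upTo m)

-- coefficient of x^m in a = Σ_{n ∈ ℤ, n ≡ 1 mod 3} x^(n^2):
-- the parity of #{ n ∈ ℤ : n ≡ 1 (mod 3), n^2 = m }.
-- (Any n with n^2 = m satisfies |n| ≤ m, so it suffices to range over -m..m.)
aCoeff : ℕ → Bool
aCoeff m = sumF2 (map (λ n → ⌊ (n % (+ 3)) ℕ.≟ 1 ⌋ ∧ ⌊ n ℤ.* n ℤ.≟ + m ⌋) (intRange m))

PowerSeries : Set
PowerSeries = ℕ → Bool

conv : PowerSeries → PowerSeries → PowerSeries
conv c d k = sumF2 (map (λ i → c i ∧ d (k ∸ i)) (upTo (suc k)))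

-- Laurent series over Z/2: x^val * (power series coef)
record Laurent : Set where
  constructor laurent
  field
    val  : ℤ
    coef : PowerSeries
open Laurent public

coeffL : Laurent → ℤ → Bool
coeffL f n with n ℤ.- val f
... | + k      = coef f k
... | -[1+ _ ] = false

mulL : Laurent → Laurent → Laurent
mulL f g = laurent (val f ℤ.+ val g) (conv (coef f) (coef g))

oneL : Laurent
oneL = laurent (+ 0) (λ { zero → true ; (suc _) → false })

aL : Laurent
aL = laurent (+ 0) aCoeff

IsInverseOfA : Laurent → Set
IsInverseOfA b = ∀ (n : ℤ) → coeffL (mulL aL b) n ≡ coeffL oneL n
  where open import Relation.Binary.PropositionalEquality using (_≡_)

InB : Laurent → ℤ → Set
InB b n = coeffL b n ≡ true
  where open import Relation.Binary.PropositionalEquality using (_≡_)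

-- Over ℤ/2 squaring is additive, so f ⊛ f = f(x²) for every power series f.  The coefficient
-- of x^m in a is 1 exactly when m = r² with 3 ∤ r (then exactly one of ±r is ≡ 1 mod 3), so
-- 4r² ∈ supp a ⇔ r² ∈ supp a while 4z + 2 is never a square: the even part of a is a(x⁴) = a⁴.
-- Write 1/a = x⁻ᵘ c, so that c a = xᵘ.  Then c a² = xᵘ a, and multiplying by the even series
-- a² = a(x²) commutes with taking the part of a given parity; the part of parity u therefore
-- satisfies c_u a² = xᵘ a⁴, i.e. c_u = xᵘ a(x²).  Hence the coefficient of xⁿ in 1/a for even
-- n is the coefficient of x^(n/2) in a, which vanishes unless n/2 is a square.
module Submission where

open import Defs
open import Data.Integer using (ℤ; +_; _*_)
open import Data.Integer.DivMod using (_/_)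
open import Data.Integer.Divisibility using (_∣_)
open import Data.Product using (∃; _,_; _×_)
open import Relation.Binary.PropositionalEquality using (_≡_)

open import Algebra.Bundles using (CommutativeRing)
open import Data.Bool using (Bool; true; false; not; _xor_; _∧_)
open import Data.Bool.Properties
  using ( xor-∧-commutativeRing; xor-assoc; xor-comm; xor-same; xor-identityʳ; ¬-not
        ; ∧-assoc; ∧-comm; ∧-idem; ∧-identityʳ; ∧-zeroʳ; ∧-conicalʳ; ∧-distribˡ-xor; ∧-distribʳ-xor )
open import Data.List using ([]; _∷_; map; upTo; _++_)
open import Data.List.Properties using (map-applyUpTo; map-upTo; map-++; map-∘)
open import Data.Nat as ℕ using (ℕ; zero; suc; _∸_; _<_; s<s; parity)
import Data.Nat.Properties as ℕ
import Data.Nat.DivMod as ℕ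
import Data.Nat.Divisibility as ℕ
import Data.Nat.Tactic.RingSolver as ℕ-Solver
open import Data.Integer as ℤ using (-[1+_]; ∣_∣; _⊖_)
open import Data.Integer.Tactic.RingSolver using (solve-∀)
import Data.Integer.Properties as ℤ
open import Data.Integer.DivMod using (_%_)
open import Data.Parity using (Parity; 0ℙ; 1ℙ; _⁻¹)
import Data.Parity.Properties as ℙ
open import Function using (_∘_)
open import Data.Empty using (⊥-elim)
open import Relation.Binary using (tri<; tri≈; tri>)
open import Relation.Binary.PropositionalEquality
  using (_≢_; refl; sym; trans; cong; cong₂; subst; _≗_; _→-setoid_; module ≡-Reasoning)
open import Relation.Nullary using (Dec; yes; ¬_; contradiction)
open import Relation.Nullary.Decidable using (⌊_⌋; isYes≗does; dec-true; dec-false)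
import Relation.Binary.Reasoning.Setoid as SetoidReasoning

open CommutativeRing xor-∧-commutativeRing using (+-commutativeSemigroup)
open import Algebra.Properties.CommutativeSemigroup +-commutativeSemigroup
  using (interchange; x∙yz≈y∙xz)

𝟘 𝟙 : PowerSeries
𝟘 _ = false
𝟙 = coef oneL

infixl 6 _⊕_
_⊕_ : PowerSeries → PowerSeries → PowerSeries
(f ⊕ g) k = f k xor g k

infixr 8 _·_
_·_ : Bool → PowerSeries → PowerSeries
(c · f) k = c ∧ f k

tail : PowerSeries → PowerSeries
tail f = f ∘ suc

shift : ℕ → PowerSeries → PowerSeries
shift zero    f k       = f k
shift (suc m) f zero    = false
shift (suc m) f (suc k) = shift m f k

infixl 7 _⊛_
_⊛_ : PowerSeries → PowerSeries → PowerSeries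
(f ⊛ g) zero    = f 0 ∧ g 0
(f ⊛ g) (suc k) = (f 0 ∧ g (suc k)) xor (tail f ⊛ g) k

sumF2-upTo-suc : ∀ (h : ℕ → Bool) n →
  sumF2 (map h (upTo (suc n))) ≡ h 0 xor sumF2 (map (h ∘ suc) (upTo n))
sumF2-upTo-suc h n =
  cong (λ l → h 0 xor sumF2 l) (trans (map-applyUpTo suc h n) (sym (map-upTo (h ∘ suc) n)))

conv≗⊛ : ∀ f g → conv f g ≗ f ⊛ g
conv≗⊛ f g zero    = xor-identityʳ (f 0 ∧ g 0)
conv≗⊛ f g (suc k) =
  trans (sumF2-upTo-suc (λ i → f i ∧ g (suc k ∸ i)) (suc k))
        (cong (f 0 ∧ g (suc k) xor_) (conv≗⊛ (tail f) g k))

⊛-cong : ∀ {f f′ g g′} → f ≗ f′ → g ≗ g′ → f ⊛ g ≗ f′ ⊛ g′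
⊛-cong f≗f′ g≗g′ zero    = cong₂ _∧_ (f≗f′ 0) (g≗g′ 0)
⊛-cong f≗f′ g≗g′ (suc k) =
  cong₂ _xor_ (cong₂ _∧_ (f≗f′ 0) (g≗g′ (suc k))) (⊛-cong (f≗f′ ∘ suc) g≗g′ k)

⊛-zeroˡ : ∀ g → 𝟘 ⊛ g ≗ 𝟘
⊛-zeroˡ g zero    = refl
⊛-zeroˡ g (suc k) = ⊛-zeroˡ g k

⊛-identityˡ : ∀ f → 𝟙 ⊛ f ≗ f
⊛-identityˡ f zero    = refl
⊛-identityˡ f (suc k) = trans (cong (f (suc k) xor_) (⊛-zeroˡ f k)) (xor-identityʳ (f (suc k)))

shift-⊛ : ∀ m f g → shift m f ⊛ g ≗ shift m (f ⊛ g)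
shift-⊛ zero    f g k       = ⊛-cong (λ _ → refl) (λ _ → refl) k
shift-⊛ (suc m) f g zero    = refl
shift-⊛ (suc m) f g (suc k) = shift-⊛ m f g k

shift-cong : ∀ m {f g} → f ≗ g → shift m f ≗ shift m g
shift-cong zero    f≗g k       = f≗g k
shift-cong (suc m) f≗g zero    = refl
shift-cong (suc m) f≗g (suc k) = shift-cong m f≗g k

shift-+ : ∀ m f k → shift m f (m ℕ.+ k) ≡ f k
shift-+ zero    f k = refl
shift-+ (suc m) f k = shift-+ m f k

·-⊛ : ∀ c f g → (c · f) ⊛ g ≗ c · (f ⊛ g)
·-⊛ c f g zero    = ∧-assoc c (f 0) (g 0)
·-⊛ c f g (suc k) = begin
  (c ∧ f 0) ∧ g (suc k) xor (tail (c · f) ⊛ g) k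
    ≡⟨ cong₂ _xor_ (∧-assoc c (f 0) (g (suc k))) (·-⊛ c (tail f) g k) ⟩
  c ∧ (f 0 ∧ g (suc k)) xor c ∧ (tail f ⊛ g) k
    ≡⟨ ∧-distribˡ-xor c _ _ ⟨
  c ∧ (f ⊛ g) (suc k) ∎
  where open ≡-Reasoning

⊛-distribʳ : ∀ f g h → (f ⊕ g) ⊛ h ≗ f ⊛ h ⊕ g ⊛ h
⊛-distribʳ f g h zero    = ∧-distribʳ-xor (h 0) (f 0) (g 0)
⊛-distribʳ f g h (suc k) = begin
  (f 0 xor g 0) ∧ h (suc k) xor (tail (f ⊕ g) ⊛ h) k
    ≡⟨ cong₂ _xor_ (∧-distribʳ-xor (h (suc k)) (f 0) (g 0)) (⊛-distribʳ (tail f) (tail g) h k) ⟩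
  (f 0 ∧ h (suc k) xor g 0 ∧ h (suc k)) xor ((tail f ⊛ h) k xor (tail g ⊛ h) k)
    ≡⟨ interchange (f 0 ∧ h (suc k)) (g 0 ∧ h (suc k)) _ _ ⟩
  (f ⊛ h ⊕ g ⊛ h) (suc k) ∎
  where open ≡-Reasoning

⊛-comm : ∀ f g → f ⊛ g ≗ g ⊛ f
⊛-comm f g zero             = ∧-comm (f 0) (g 0)
⊛-comm f g (suc zero)       =
  trans (cong₂ _xor_ (∧-comm (f 0) (g 1)) (∧-comm (f 1) (g 0))) (xor-comm (g 1 ∧ f 0) (g 0 ∧ f 1))
⊛-comm f g (suc (suc k))    = begin
  f 0 ∧ g (2 ℕ.+ k) xor (tail f ⊛ g) (suc k)
    ≡⟨ cong (f 0 ∧ g (2 ℕ.+ k) xor_) (⊛-comm (tail f) g (suc k)) ⟩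
  f 0 ∧ g (2 ℕ.+ k) xor (g 0 ∧ f (2 ℕ.+ k) xor (tail g ⊛ tail f) k)
    ≡⟨ cong (λ z → f 0 ∧ g (2 ℕ.+ k) xor (g 0 ∧ f (2 ℕ.+ k) xor z)) (⊛-comm (tail g) (tail f) k) ⟩
  f 0 ∧ g (2 ℕ.+ k) xor (g 0 ∧ f (2 ℕ.+ k) xor (tail f ⊛ tail g) k)
    ≡⟨ x∙yz≈y∙xz (f 0 ∧ g (2 ℕ.+ k)) (g 0 ∧ f (2 ℕ.+ k)) _ ⟩
  g 0 ∧ f (2 ℕ.+ k) xor (f 0 ∧ g (2 ℕ.+ k) xor (tail f ⊛ tail g) k)
    ≡⟨ cong (g 0 ∧ f (2 ℕ.+ k) xor_) (⊛-comm f (tail g) (suc k)) ⟩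
  g 0 ∧ f (2 ℕ.+ k) xor (tail g ⊛ f) (suc k) ∎
  where open ≡-Reasoning

⊛-unfold : ∀ f g → f ⊛ g ≗ f 0 · g ⊕ shift 1 (tail f ⊛ g)
⊛-unfold f g zero    = sym (xor-identityʳ (f 0 ∧ g 0))
⊛-unfold f g (suc k) = refl

⊛-assoc : ∀ f g h → (f ⊛ g) ⊛ h ≗ f ⊛ (g ⊛ h)
⊛-assoc f g h zero    = ∧-assoc (f 0) (g 0) (h 0)
⊛-assoc f g h (suc k) = begin
  ((f ⊛ g) ⊛ h) (suc k)
    ≡⟨ ⊛-cong (⊛-unfold f g) (λ _ → refl) (suc k) ⟩
  ((f 0 · g ⊕ shift 1 (tail f ⊛ g)) ⊛ h) (suc k)
    ≡⟨ ⊛-distribʳ (f 0 · g) (shift 1 (tail f ⊛ g)) h (suc k) ⟩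
  ((f 0 · g) ⊛ h) (suc k) xor (shift 1 (tail f ⊛ g) ⊛ h) (suc k)
    ≡⟨ cong₂ _xor_ (·-⊛ (f 0) g h (suc k)) (shift-⊛ 1 (tail f ⊛ g) h (suc k)) ⟩
  f 0 ∧ (g ⊛ h) (suc k) xor ((tail f ⊛ g) ⊛ h) k
    ≡⟨ cong (f 0 ∧ (g ⊛ h) (suc k) xor_) (⊛-assoc (tail f) g h k) ⟩
  (f ⊛ (g ⊛ h)) (suc k) ∎
  where open ≡-Reasoning

⊛-cancel : ∀ {f g} → g 0 ≡ true → f ⊛ g ≗ 𝟘 → f ≗ 𝟘
⊛-cancel {f} {g} g₀ fg≗𝟘 zero    = f₀
  where
  f₀ : f 0 ≡ false
  f₀ = trans (sym (trans (cong (f 0 ∧_) g₀) (∧-identityʳ (f 0)))) (fg≗𝟘 0)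
⊛-cancel {f} {g} g₀ fg≗𝟘 (suc k) = ⊛-cancel g₀ tail-fg≗𝟘 k
  where
  tail-fg≗𝟘 : tail f ⊛ g ≗ 𝟘
  tail-fg≗𝟘 j =
    trans (cong (λ b → b ∧ g (suc j) xor (tail f ⊛ g) j) (sym (⊛-cancel g₀ fg≗𝟘 0))) (fg≗𝟘 (suc j))

⊛-cancel-shift : ∀ {f a g} m → a ≗ shift m g → g 0 ≡ true → f ⊛ a ≗ 𝟘 → f ≗ 𝟘
⊛-cancel-shift {f} {a} {g} m a≗xᵐg g₀ fa≗𝟘 = ⊛-cancel g₀ fg≗𝟘
  where
  fg≗𝟘 : f ⊛ g ≗ 𝟘
  fg≗𝟘 k = begin
    (f ⊛ g) k                  ≡⟨ ⊛-comm f g k ⟩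
    (g ⊛ f) k                  ≡⟨ shift-+ m (g ⊛ f) k ⟨
    shift m (g ⊛ f) (m ℕ.+ k)  ≡⟨ shift-⊛ m g f (m ℕ.+ k) ⟨
    (shift m g ⊛ f) (m ℕ.+ k)  ≡⟨ ⊛-cong (λ i → sym (a≗xᵐg i)) (λ _ → refl) (m ℕ.+ k) ⟩
    (a ⊛ f) (m ℕ.+ k)          ≡⟨ ⊛-comm a f (m ℕ.+ k) ⟩
    (f ⊛ a) (m ℕ.+ k)          ≡⟨ fa≗𝟘 (m ℕ.+ k) ⟩
    false                      ∎
    where open ≡-Reasoning

infixl 9 _[x²]
_[x²] : PowerSeries → PowerSeries
(f [x²]) zero          = f 0
(f [x²]) (suc zero)    = false
(f [x²]) (suc (suc k)) = (tail f [x²]) k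

frobenius : ∀ f → f ⊛ f ≗ f [x²]
frobenius f zero          = ∧-idem (f 0)
frobenius f (suc zero)    = trans (cong (f 0 ∧ f 1 xor_) (∧-comm (f 1) (f 0))) (xor-same (f 0 ∧ f 1))
frobenius f (suc (suc k)) = begin
  f 0 ∧ f (2 ℕ.+ k) xor (tail f ⊛ f) (suc k)
    ≡⟨ cong (f 0 ∧ f (2 ℕ.+ k) xor_) (⊛-comm (tail f) f (suc k)) ⟩
  f 0 ∧ f (2 ℕ.+ k) xor (f 0 ∧ f (2 ℕ.+ k) xor (tail f ⊛ tail f) k)
    ≡⟨ xor-assoc (f 0 ∧ f (2 ℕ.+ k)) _ _ ⟨
  (f 0 ∧ f (2 ℕ.+ k) xor f 0 ∧ f (2 ℕ.+ k)) xor (tail f ⊛ tail f) k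
    ≡⟨ cong (_xor (tail f ⊛ tail f) k) (xor-same (f 0 ∧ f (2 ℕ.+ k))) ⟩
  (tail f ⊛ tail f) k
    ≡⟨ frobenius (tail f) k ⟩
  (tail f [x²]) k ∎
  where open ≡-Reasoning

[x²]-shift : ∀ f → f 0 ≡ false → f [x²] ≗ shift 2 (tail f [x²])
[x²]-shift f f₀ zero          = f₀
[x²]-shift f f₀ (suc zero)    = refl
[x²]-shift f f₀ (suc (suc k)) = refl

shift-tail : ∀ f → f 0 ≡ false → f ≗ shift 1 (tail f)
shift-tail f f₀ zero    = f₀
shift-tail f f₀ (suc k) = refl

parityPart : Parity → PowerSeries → PowerSeries
parityPart p f k = f k ∧ ⌊ parity k ℙ.≟ p ⌋

parityPart-cong : ∀ p {f g} → f ≗ g → parityPart p f ≗ parityPart p g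
parityPart-cong p f≗g k = cong (_∧ ⌊ parity k ℙ.≟ p ⌋) (f≗g k)

parityPart-shift : ∀ m f → parityPart (parity m) (shift m f) ≗ shift m (parityPart 0ℙ f)
parityPart-shift zero    f k       = refl
parityPart-shift (suc m) f zero    = refl
parityPart-shift (suc m) f (suc k) =
  trans (cong (shift m f k ∧_) (≟-⁻¹ (parity (suc k)) (parity (suc m))))
        (trans (cong₂ (λ q p → shift m f k ∧ ⌊ q ℙ.≟ p ⌋) (ℙ.suc-homo-⁻¹ k) (ℙ.suc-homo-⁻¹ m))
               (parityPart-shift m f k))
  where
  ≟-⁻¹ : ∀ q p → ⌊ q ℙ.≟ p ⌋ ≡ ⌊ q ⁻¹ ℙ.≟ p ⁻¹ ⌋
  ≟-⁻¹ 0ℙ 0ℙ = refl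
  ≟-⁻¹ 0ℙ 1ℙ = refl
  ≟-⁻¹ 1ℙ 0ℙ = refl
  ≟-⁻¹ 1ℙ 1ℙ = refl

parityPart-[x²]⊛ : ∀ p g f → parityPart p (g [x²] ⊛ f) ≗ g [x²] ⊛ parityPart p f
parityPart-[x²]⊛ p g f zero          = ∧-assoc (g 0) (f 0) _
parityPart-[x²]⊛ p g f (suc zero)    =
  trans (cong (_∧ ⌊ 1ℙ ℙ.≟ p ⌋) (xor-identityʳ (g 0 ∧ f 1)))
        (trans (∧-assoc (g 0) (f 1) _) (sym (xor-identityʳ _)))
parityPart-[x²]⊛ p g f (suc (suc k)) = begin
  (g 0 ∧ f (2 ℕ.+ k) xor ((tail g [x²]) ⊛ f) k) ∧ t
    ≡⟨ ∧-distribʳ-xor t (g 0 ∧ f (2 ℕ.+ k)) _ ⟩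
  (g 0 ∧ f (2 ℕ.+ k)) ∧ t xor ((tail g [x²]) ⊛ f) k ∧ t
    ≡⟨ cong₂ _xor_ (∧-assoc (g 0) (f (2 ℕ.+ k)) t) (parityPart-[x²]⊛ p (tail g) f k) ⟩
  (g [x²] ⊛ parityPart p f) (suc (suc k)) ∎
  where
  open ≡-Reasoning
  t = ⌊ parity k ℙ.≟ p ⌋

xor≡false⇒≡ : ∀ {x y} → x xor y ≡ false → x ≡ y
xor≡false⇒≡ {false} {false} _ = refl
xor≡false⇒≡ {true}  {true}  _ = refl

parityPart-quotient : ∀ {a c} u → a 0 ≡ false → a 1 ≡ true → parityPart 0ℙ a ≗ a [x²] [x²] →
  c ⊛ a ≗ shift u 𝟙 → parityPart (parity u) c ≗ shift u (a [x²])
parityPart-quotient {a} {c} u a₀ a₁ even-a ca≗xᵘ k = xor≡false⇒≡ (difference≗𝟘 k)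
  where
  open SetoidReasoning (ℕ →-setoid Bool)
  s  = a [x²]
  cₚ = parityPart (parity u) c

  cs≗xᵘa : c ⊛ s ≗ shift u a
  cs≗xᵘa = begin
    c ⊛ s             ≈⟨ ⊛-cong (λ _ → refl) (frobenius a) ⟨
    c ⊛ (a ⊛ a)       ≈⟨ ⊛-assoc c a a ⟨
    (c ⊛ a) ⊛ a       ≈⟨ ⊛-cong ca≗xᵘ (λ _ → refl) ⟩
    shift u 𝟙 ⊛ a     ≈⟨ shift-⊛ u 𝟙 a ⟩
    shift u (𝟙 ⊛ a)   ≈⟨ shift-cong u (⊛-identityˡ a) ⟩
    shift u a         ∎

  cₚs≗xᵘss : cₚ ⊛ s ≗ shift u s ⊛ s
  cₚs≗xᵘss = begin
    cₚ ⊛ s                            ≈⟨ ⊛-comm cₚ s ⟩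
    s ⊛ cₚ                            ≈⟨ parityPart-[x²]⊛ (parity u) a c ⟨
    parityPart (parity u) (s ⊛ c)     ≈⟨ parityPart-cong (parity u) (⊛-comm s c) ⟩
    parityPart (parity u) (c ⊛ s)     ≈⟨ parityPart-cong (parity u) cs≗xᵘa ⟩
    parityPart (parity u) (shift u a) ≈⟨ parityPart-shift u a ⟩
    shift u (parityPart 0ℙ a)         ≈⟨ shift-cong u even-a ⟩
    shift u (s [x²])                  ≈⟨ shift-cong u (frobenius s) ⟨
    shift u (s ⊛ s)                   ≈⟨ shift-⊛ u s s ⟨
    shift u s ⊛ s                     ∎

  difference≗𝟘 : cₚ ⊕ shift u s ≗ 𝟘
  difference≗𝟘 = ⊛-cancel-shift 2 ([x²]-shift a a₀) a₁ λ j →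
    trans (⊛-distribʳ cₚ (shift u s) s j)
          (trans (cong (_xor (shift u s ⊛ s) j) (cₚs≗xᵘss j)) (xor-same ((shift u s ⊛ s) j)))

data EvenOdd : ℕ → Set where
  even : ∀ y → EvenOdd (y ℕ.* 2)
  odd  : ∀ y → EvenOdd (suc (y ℕ.* 2))

evenOdd : ∀ n → EvenOdd n
evenOdd zero    = even 0
evenOdd (suc n) with evenOdd n
... | even y = odd y
... | odd y  = even (suc y)

parity-even : ∀ y → parity (y ℕ.* 2) ≡ 0ℙ
parity-even zero    = refl
parity-even (suc y) = parity-even y

parity-odd : ∀ y → parity (suc (y ℕ.* 2)) ≡ 1ℙ
parity-odd zero    = refl
parity-odd (suc y) = parity-odd y

[x²]-even : ∀ f y → (f [x²]) (y ℕ.* 2) ≡ f y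
[x²]-even f zero    = refl
[x²]-even f (suc y) = [x²]-even (tail f) y

[x²]-odd : ∀ f y → (f [x²]) (suc (y ℕ.* 2)) ≡ false
[x²]-odd f zero    = refl
[x²]-odd f (suc y) = [x²]-odd (tail f) y

square-injective : ∀ {m n} → m ℕ.* m ≡ n ℕ.* n → m ≡ n
square-injective {m} {n} eq with ℕ.<-cmp m n
... | tri< m<n _ _ = ⊥-elim (ℕ.<-irrefl eq (ℕ.*-mono-< m<n m<n))
... | tri≈ _ m≡n _ = m≡n
... | tri> _ _ n<m = ⊥-elim (ℕ.<-irrefl (sym eq) (ℕ.*-mono-< n<m n<m))

sumF2-++ : ∀ xs ys → sumF2 (xs ++ ys) ≡ sumF2 xs xor sumF2 ys
sumF2-++ []       ys = refl
sumF2-++ (x ∷ xs) ys = trans (cong (x xor_) (sumF2-++ xs ys)) (sym (xor-assoc x _ _))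

sumF2-map-false : ∀ {A : Set} (h : A → Bool) xs → (∀ x → h x ≡ false) → sumF2 (map h xs) ≡ false
sumF2-map-false h []       h≡false = refl
sumF2-map-false h (x ∷ xs) h≡false = cong₂ _xor_ (h≡false x) (sumF2-map-false h xs h≡false)

sumF2-map-true : ∀ {A : Set} (h : A → Bool) xs → sumF2 (map h xs) ≡ true → ∃ λ x → h x ≡ true
sumF2-map-true h (x ∷ xs) sum≡true with h x in hx
... | true  = x , hx
... | false = sumF2-map-true h xs sum≡true

sumF2-upTo-single : ∀ (h : ℕ → Bool) {n j} → j < n → (∀ i → i ≢ j → h i ≡ false) →
  sumF2 (map h (upTo n)) ≡ h j
sumF2-upTo-single h {suc n} {zero}  j<n others =
  trans (sumF2-upTo-suc h n)
        (trans (cong (h 0 xor_) (sumF2-map-false (h ∘ suc) (upTo n) (λ i → others (suc i) λ ())))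
               (xor-identityʳ (h 0)))
sumF2-upTo-single h {suc n} {suc j} (s<s j<n) others =
  trans (sumF2-upTo-suc h n)
        (cong₂ _xor_ (others 0 λ ())
                     (sumF2-upTo-single (h ∘ suc) j<n λ i i≢j → others (suc i) (i≢j ∘ ℕ.suc-injective)))

⌊⌋≡true⇒ : ∀ {P : Set} (P? : Dec P) → ⌊ P? ⌋ ≡ true → P
⌊⌋≡true⇒ (yes p) _ = p

⌊⌋-true : ∀ {P : Set} (P? : Dec P) → P → ⌊ P? ⌋ ≡ true
⌊⌋-true P? p = trans (isYes≗does P?) (dec-true P? p)

⌊⌋-false : ∀ {P : Set} (P? : Dec P) → ¬ P → ⌊ P? ⌋ ≡ false
⌊⌋-false P? ¬p = trans (isYes≗does P?) (dec-false P? ¬p)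

aTerm : ℕ → ℤ → Bool
aTerm m n = ⌊ (n % + 3) ℕ.≟ 1 ⌋ ∧ ⌊ n * n ℤ.≟ + m ⌋

abs-square : ∀ n {m} → n * n ≡ + m → ∣ n ∣ ℕ.* ∣ n ∣ ≡ m
abs-square n eq = trans (sym (ℤ.abs-* n n)) (cong ∣_∣ eq)

IsSquare : ℕ → Set
IsSquare m = ∃ λ r → r ℕ.* r ≡ m

aCoeff⇒square : ∀ m → aCoeff m ≡ true → IsSquare m
aCoeff⇒square m aₘ with sumF2-map-true (aTerm m) (intRange m) aₘ
... | n , term≡true = ∣ n ∣ , abs-square n (⌊⌋≡true⇒ (n * n ℤ.≟ + m) (∧-conicalʳ _ _ term≡true))

aCoeff-split : ∀ m → aCoeff m ≡
  sumF2 (map (aTerm m ∘ +_) (upTo (suc m))) xor sumF2 (map (aTerm m ∘ -[1+_]) (upTo m))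
aCoeff-split m =
  trans (cong sumF2 (map-++ (aTerm m) (map +_ (upTo (suc m))) (map -[1+_] (upTo m))))
    (trans (sumF2-++ (map (aTerm m) (map +_ (upTo (suc m)))) (map (aTerm m) (map -[1+_] (upTo m))))
      (cong₂ _xor_ (cong sumF2 (sym (map-∘ {g = aTerm m} {f = +_} (upTo (suc m)))))
                   (cong sumF2 (sym (map-∘ {g = aTerm m} {f = -[1+_]} (upTo m))))))

residue-±1 : ∀ i →
  ⌊ suc i ℕ.% 3 ℕ.≟ 1 ⌋ xor ⌊ -[1+ i ] % + 3 ℕ.≟ 1 ⌋ ≡ not ⌊ suc i ℕ.% 3 ℕ.≟ 0 ⌋
residue-±1 i with suc i ℕ.% 3 | ℕ.m%n<n (suc i) 3
... | 0 | _ = refl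
... | 1 | _ = refl
... | 2 | _ = refl
... | suc (suc (suc _)) | s<s (s<s (s<s ()))

aCoeff-square : ∀ r → aCoeff (r ℕ.* r) ≡ not ⌊ r ℕ.% 3 ℕ.≟ 0 ⌋
aCoeff-square zero    = refl
aCoeff-square (suc i) = begin
  aCoeff m
    ≡⟨ aCoeff-split m ⟩
  sumF2 (map (aTerm m ∘ +_) (upTo (suc m))) xor sumF2 (map (aTerm m ∘ -[1+_]) (upTo m))
    ≡⟨ cong₂ _xor_
         (sumF2-upTo-single (aTerm m ∘ +_) (s<s r≤m) λ j j≢r → aTerm-nonroot (+ j) j≢r)
         (sumF2-upTo-single (aTerm m ∘ -[1+_]) r≤m λ j j≢i → aTerm-nonroot -[1+ j ] (j≢i ∘ ℕ.suc-injective)) ⟩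
  aTerm m (+ suc i) xor aTerm m -[1+ i ]
    ≡⟨ cong₂ _xor_ (aTerm-root (+ suc i) (sym (ℤ.pos-* (suc i) (suc i)))) (aTerm-root -[1+ i ] refl) ⟩
  ⌊ suc i ℕ.% 3 ℕ.≟ 1 ⌋ xor ⌊ -[1+ i ] % + 3 ℕ.≟ 1 ⌋
    ≡⟨ residue-±1 i ⟩
  not ⌊ suc i ℕ.% 3 ℕ.≟ 0 ⌋ ∎
  where
  open ≡-Reasoning
  m = suc i ℕ.* suc i
  r≤m : suc i ℕ.≤ m
  r≤m = ℕ.m≤m*n (suc i) (suc i)
  aTerm-nonroot : ∀ n → ∣ n ∣ ≢ suc i → aTerm m n ≡ false
  aTerm-nonroot n ∣n∣≢r =
    trans (cong (_ ∧_) (⌊⌋-false (n * n ℤ.≟ + m) (∣n∣≢r ∘ square-injective ∘ abs-square n)))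
          (∧-zeroʳ _)
  aTerm-root : ∀ n → n * n ≡ + m → aTerm m n ≡ ⌊ n % + 3 ℕ.≟ 1 ⌋
  aTerm-root n nn≡m = trans (cong (_ ∧_) (⌊⌋-true (n * n ℤ.≟ + m) nn≡m)) (∧-identityʳ _)

residue-double : ∀ r → ⌊ r ℕ.* 2 ℕ.% 3 ℕ.≟ 0 ⌋ ≡ ⌊ r ℕ.% 3 ℕ.≟ 0 ⌋
residue-double r =
  trans (cong (λ x → ⌊ x ℕ.≟ 0 ⌋) (ℕ.%-distribˡ-* r 2 3)) (by-residue (r ℕ.% 3) (ℕ.m%n<n r 3))
  where
  by-residue : ∀ q → q < 3 → ⌊ q ℕ.* 2 ℕ.% 3 ℕ.≟ 0 ⌋ ≡ ⌊ q ℕ.≟ 0 ⌋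
  by-residue 0 _ = refl
  by-residue 1 _ = refl
  by-residue 2 _ = refl
  by-residue (suc (suc (suc _))) (s<s (s<s (s<s ())))

even≢odd : ∀ m t → m ℕ.* 2 ≢ suc (t ℕ.* 2)
even≢odd m t eq with trans (sym (parity-even m)) (trans (cong parity eq) (parity-odd t))
... | ()

odd-square : ∀ s → suc (s ℕ.* 2) ℕ.* suc (s ℕ.* 2) ≡ suc ((s ℕ.* s ℕ.* 2 ℕ.+ s ℕ.* 2) ℕ.* 2)
odd-square = ℕ-Solver.solve-∀

double-square : ∀ s → s ℕ.* 2 ℕ.* (s ℕ.* 2) ≡ s ℕ.* s ℕ.* 2 ℕ.* 2
double-square = ℕ-Solver.solve-∀

halve-square : ∀ {m} → IsSquare (m ℕ.* 2) → ∃ λ s → s ℕ.* s ℕ.* 2 ≡ m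
halve-square {m} (r , rr≡2m) with evenOdd r
... | even s = s , ℕ.*-cancelʳ-≡ _ _ 2 (trans (sym (double-square s)) rr≡2m)
... | odd s  = ⊥-elim (even≢odd m (s ℕ.* s ℕ.* 2 ℕ.+ s ℕ.* 2) (trans (sym rr≡2m) (odd-square s)))

quarter-square : ∀ {z} → IsSquare (z ℕ.* 2 ℕ.* 2) → IsSquare z
quarter-square {z} 4z-square with halve-square {z ℕ.* 2} 4z-square
... | s , 2ss≡2z = s , ℕ.*-cancelʳ-≡ _ _ 2 2ss≡2z

not-square-2mod4 : ∀ z → ¬ IsSquare (suc (z ℕ.* 2) ℕ.* 2)
not-square-2mod4 z 4z+2-square with halve-square {suc (z ℕ.* 2)} 4z+2-square
... | s , 2ss≡2z+1 = even≢odd (s ℕ.* s) z 2ss≡2z+1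

bool-≡ : ∀ {x y} → (x ≡ true → x ≡ y) → (y ≡ true → x ≡ y) → x ≡ y
bool-≡ {true}          x⇒ _  = x⇒ refl
bool-≡ {false} {true}  _  y⇒ = y⇒ refl
bool-≡ {false} {false} _  _  = refl

aCoeff-×4 : ∀ z → aCoeff (z ℕ.* 2 ℕ.* 2) ≡ aCoeff z
aCoeff-×4 z = bool-≡ (on-square ∘ quarter-square ∘ aCoeff⇒square _) (on-square ∘ aCoeff⇒square z)
  where
  open ≡-Reasoning
  on-square : IsSquare z → aCoeff (z ℕ.* 2 ℕ.* 2) ≡ aCoeff z
  on-square (r , refl) = begin
    aCoeff (r ℕ.* r ℕ.* 2 ℕ.* 2)     ≡⟨ cong aCoeff (double-square r) ⟨
    aCoeff (r ℕ.* 2 ℕ.* (r ℕ.* 2))   ≡⟨ aCoeff-square (r ℕ.* 2) ⟩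
    not ⌊ r ℕ.* 2 ℕ.% 3 ℕ.≟ 0 ⌋      ≡⟨ cong not (residue-double r) ⟩
    not ⌊ r ℕ.% 3 ℕ.≟ 0 ⌋            ≡⟨ aCoeff-square r ⟨
    aCoeff (r ℕ.* r)                 ∎

aCoeff-2mod4 : ∀ z → aCoeff (suc (z ℕ.* 2) ℕ.* 2) ≡ false
aCoeff-2mod4 z = ¬-not (not-square-2mod4 z ∘ aCoeff⇒square _)

aCoeff-evenPart : parityPart 0ℙ aCoeff ≗ aCoeff [x²] [x²]
aCoeff-evenPart k with evenOdd k
... | odd y  = trans (cong (aCoeff (suc (y ℕ.* 2)) ∧_) (cong (λ p → ⌊ p ℙ.≟ 0ℙ ⌋) (parity-odd y)))
                     (trans (∧-zeroʳ _) (sym ([x²]-odd (aCoeff [x²]) y)))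
... | even y = trans (cong (aCoeff (y ℕ.* 2) ∧_) (cong (λ p → ⌊ p ℙ.≟ 0ℙ ⌋) (parity-even y)))
                     (trans (∧-identityʳ _) (trans (at-double y) (sym ([x²]-even (aCoeff [x²]) y))))
  where
  at-double : ∀ y → aCoeff (y ℕ.* 2) ≡ (aCoeff [x²]) y
  at-double y with evenOdd y
  ... | even z = trans (aCoeff-×4 z) (sym ([x²]-even aCoeff z))
  ... | odd z  = trans (aCoeff-2mod4 z) (sym ([x²]-odd aCoeff z))

shift-[x²]-true : ∀ m f k → shift m (f [x²]) k ≡ true → ∃ λ y → k ≡ m ℕ.+ y ℕ.* 2 × f y ≡ true
shift-[x²]-true zero    f k xᵐf[x²]ₖ with evenOdd k
... | even y = y , refl , trans (sym ([x²]-even f y)) xᵐf[x²]ₖ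
... | odd y  with trans (sym ([x²]-odd f y)) xᵐf[x²]ₖ
...   | ()
shift-[x²]-true (suc m) f (suc k) xᵐf[x²]ₖ with shift-[x²]-true m f k xᵐf[x²]ₖ
... | y , refl , fᵧ = y , refl , fᵧ

parity-of-even : ∀ {m} → 2 ℕ.∣ m → parity m ≡ 0ℙ
parity-of-even (ℕ.divides q refl) = parity-even q

parity-⊖ : ∀ k u → (+ 2) ∣ (k ⊖ u) → parity k ≡ parity u
parity-⊖ k       zero    2∣k   = parity-of-even 2∣k
parity-⊖ zero    (suc u) 2∣1+u = sym (parity-of-even 2∣1+u)
parity-⊖ (suc k) (suc u) 2∣k-u = ℙ.⁻¹-injective (begin
  parity (suc k) ⁻¹ ≡⟨ ℙ.suc-homo-⁻¹ k ⟩
  parity k          ≡⟨ parity-⊖ k u (subst (+ 2 ∣_) (ℤ.[1+m]⊖[1+n]≡m⊖n k u) 2∣k-u) ⟩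
  parity u          ≡⟨ ℙ.suc-homo-⁻¹ u ⟨
  parity (suc u) ⁻¹ ∎)
  where open ≡-Reasoning

m+n⊖m : ∀ m n → (m ℕ.+ n) ⊖ m ≡ + n
m+n⊖m m n = trans (ℤ.⊖-≥ (ℕ.m≤m+n m n)) (cong +_ (ℕ.m+n∸m≡n m n))

half-of-double : ∀ m → + (m ℕ.* 2) / + 2 ≡ + m
half-of-double m = trans (ℤ.*-identityˡ _) (cong +_ (ℕ.m*n/n≡m m 2))

xᵘ/a-parityPart : ∀ u {c} → aCoeff ⊛ c ≗ shift u 𝟙 → parityPart (parity u) c ≗ shift u (aCoeff [x²])
xᵘ/a-parityPart u {c} a·c≗xᵘ =
  parityPart-quotient u refl refl aCoeff-evenPart (λ j → trans (⊛-comm c aCoeff j) (a·c≗xᵘ j))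

xᵘ/a-support : ∀ u {c k} → aCoeff ⊛ c ≗ shift u 𝟙 → c k ≡ true → (+ 2) ∣ (k ⊖ u) →
  ∃ λ y → k ≡ u ℕ.+ y ℕ.* 2 × aCoeff y ≡ true
xᵘ/a-support u {c} {k} a·c≗xᵘ cₖ 2∣k-u =
  shift-[x²]-true u aCoeff k
    (trans (sym (xᵘ/a-parityPart u a·c≗xᵘ k))
           (cong₂ _∧_ cₖ (⌊⌋-true (parity k ℙ.≟ parity u) (parity-⊖ k u 2∣k-u))))

half-square : ∀ {k u y} → k ≡ u ℕ.+ y ℕ.* 2 → IsSquare y → ∃ λ r → (k ⊖ u) / + 2 ≡ r * r
half-square {k} {u} {y} k≡u+2y (r , rr≡y) = + r , (begin
  (k ⊖ u) / + 2               ≡⟨ cong (λ k → (k ⊖ u) / + 2) k≡u+2y ⟩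
  ((u ℕ.+ y ℕ.* 2) ⊖ u) / + 2 ≡⟨ cong (_/ + 2) (m+n⊖m u (y ℕ.* 2)) ⟩
  + (y ℕ.* 2) / + 2           ≡⟨ half-of-double y ⟩
  + y                         ≡⟨ cong +_ rr≡y ⟨
  + (r ℕ.* r)                 ≡⟨ ℤ.pos-* r r ⟩
  + r * + r                   ∎)
  where open ≡-Reasoning

xᵘ/a-even-support : ∀ u {c k} → aCoeff ⊛ c ≗ shift u 𝟙 → c k ≡ true → (+ 2) ∣ (k ⊖ u) →
  ∃ λ r → (k ⊖ u) / + 2 ≡ r * r
xᵘ/a-even-support u a·c≗xᵘ cₖ 2∣k-u =
  let y , k≡u+2y , aᵧ = xᵘ/a-support u a·c≗xᵘ cₖ 2∣k-u
  in  half-square k≡u+2y (aCoeff⇒square y aᵧ)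

v+x-v≡x : ∀ v x → (v ℤ.+ x) ℤ.- v ≡ x
v+x-v≡x = solve-∀

v+[n-v]≡n : ∀ v n → v ℤ.+ (n ℤ.- v) ≡ n
v+[n-v]≡n = solve-∀

coeffL-at : ∀ f j → coeffL f (val f ℤ.+ + j) ≡ coef f j
coeffL-at f j with (val f ℤ.+ + j) ℤ.- val f in eq
... | + k      = cong (coef f) (ℤ.+-injective (trans (sym eq) (v+x-v≡x (val f) (+ j))))
... | -[1+ _ ] with trans (sym eq) (v+x-v≡x (val f) (+ j))
...   | ()

coeffL-true : ∀ f n → coeffL f n ≡ true → ∃ λ k → n ≡ val f ℤ.+ + k × coef f k ≡ true
coeffL-true f n fₙ with n ℤ.- val f in eq
... | + k = k , trans (sym (v+[n-v]≡n (val f) n)) (cong (λ x → val f ℤ.+ x) eq) , fₙ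

coeffL-oneL : ∀ u j → coeffL oneL (j ⊖ u) ≡ shift u 𝟙 j
coeffL-oneL zero    zero    = refl
coeffL-oneL zero    (suc j) = refl
coeffL-oneL (suc u) zero    = refl
coeffL-oneL (suc u) (suc j) = trans (cong (coeffL oneL) (ℤ.[1+m]⊖[1+n]≡m⊖n j u)) (coeffL-oneL u j)

inverse-equation : ∀ b → IsInverseOfA b → aCoeff ⊛ coef b ≗ λ j → coeffL oneL (val b ℤ.+ + j)
inverse-equation b a·b≡1 j = begin
  (aCoeff ⊛ coef b) j                                  ≡⟨ conv≗⊛ aCoeff (coef b) j ⟨
  conv aCoeff (coef b) j                               ≡⟨ coeffL-at (mulL aL b) j ⟨
  coeffL (mulL aL b) (val (mulL aL b) ℤ.+ + j)         ≡⟨ a·b≡1 (val (mulL aL b) ℤ.+ + j) ⟩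
  coeffL oneL ((+ 0 ℤ.+ val b) ℤ.+ + j)                ≡⟨ cong (λ v → coeffL oneL (v ℤ.+ + j))
                                                              (ℤ.+-identityˡ (val b)) ⟩
  coeffL oneL (val b ℤ.+ + j)                          ∎
  where open ≡-Reasoning

laurent-even-support : ∀ v {c k} → aCoeff ⊛ c ≗ (λ j → coeffL oneL (v ℤ.+ + j)) → c k ≡ true →
  (+ 2) ∣ (v ℤ.+ + k) → ∃ λ r → (v ℤ.+ + k) / + 2 ≡ r * r
laurent-even-support (+ zero) a·c≗1 =
  xᵘ/a-even-support 0 λ j → trans (a·c≗1 j) (coeffL-oneL 0 j)
laurent-even-support -[1+ w ] a·c≗1 =
  xᵘ/a-even-support (suc w) λ j → trans (a·c≗1 j) (coeffL-oneL (suc w) j)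
laurent-even-support (+ suc w) {c} {k} a·c≗𝟘 cₖ = contradiction (trans (sym cₖ) (c≗𝟘 k)) λ ()
  where
  c≗𝟘 : c ≗ 𝟘
  c≗𝟘 = ⊛-cancel-shift 1 (shift-tail aCoeff refl) refl (λ j → trans (⊛-comm c aCoeff j) (a·c≗𝟘 j))

theorem2p4 : (b : Laurent) → IsInverseOfA b →
    ∀ (n : ℤ) → (+ 2) ∣ n → InB b n → ∃ λ (k : ℤ) → n / (+ 2) ≡ k * k
theorem2p4 b a·b≡1 n 2∣n bₙ with coeffL-true b n bₙ
... | k , refl , cₖ = laurent-even-support (val b) (inverse-equation b a·b≡1) cₖ 2∣n
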